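{- Let $U$ be a set and $\lesssim$ a quasiorder on $U$, and let $\mathit{RS}=\{(X^{\blacktriangledown},X^{\blacktriangle})\mid X\subseteq U\}$ be ordered coordinatewise by inclusion, where $X^{\blacktriangle}=\{x\mid [x)\cap X\neq\emptyset\}$, $X^{\blacktriangledown}=\{x\mid [x)\subseteq X\}$ and $[x)=\{y\mid x\lesssim y\}$. Let $\Rightarrow^*$ denote the relative pseudocomplement in the lattice $\langle\mathit{RS};\le\rangle$, let ${\sim}(A,B)=(B^c,A^c)$ (complements in $U$), let $a\to b:=a\Rightarrow^*({\sim}a\vee b)$, and let $a\Rightarrow b:=(a\to b)\wedge({\sim}b\to{\sim}a)$. Then for all $(A,B),(C,D)\in\mathit{RS}$, $$(A,B)\Rightarrow^*(C,D)\ \le\ (A,B)\Rightarrow(C,D)\ \le\ (A,B)\to(C,D).$$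
   Context: $\mathit{RS}$ is a complete sublattice of $\wp(U)\times\wp(U)$ (joins and meets are coordinatewise unions and intersections), hence a Heyting algebra, so $\Rightarrow^*$ (the greatest $c$ with $a\wedge c\le b$) exists; ${\sim}$ maps $\mathit{RS}$ to itself. -}

module Defs where

open import Level using (Level; suc; _⊔_)
open import Data.Product using (Σ; ∃; _×_; _,_; proj₁; proj₂)
open import Data.Sum using (_⊎_)
open import Relation.Nullary using (¬_)
open import Relation.Binary using (Rel)

Subset : ∀ {ℓ} → Set ℓ → Set (suc ℓ)
Subset {ℓ} U = U → Set ℓ

Pair : ∀ {ℓ} → Set ℓ → Set (suc ℓ)
Pair U = Subset U × Subset U

module RoughSets {ℓ : Level} (U : Set ℓ) (_≲_ : Rel U ℓ) where

  _⊆_ : Subset U → Subset U → Set ℓ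
  X ⊆ Y = ∀ x → X x → Y x

  _≐_ : Subset U → Subset U → Set ℓ
  X ≐ Y = (X ⊆ Y) × (Y ⊆ X)

  up : U → Subset U
  up x y = x ≲ y

  _▲ : Subset U → Subset U
  (X ▲) x = ∃ λ y → up x y × X y

  _▼ : Subset U → Subset U
  (X ▼) x = ∀ y → up x y → X y

  _ᶜ : Subset U → Subset U
  (X ᶜ) x = ¬ X x

  InRS : Pair U → Set (suc ℓ)
  InRS (A , B) = Σ (Subset U) λ X → (A ≐ (X ▼)) × (B ≐ (X ▲))

  _≤_ : Pair U → Pair U → Set ℓ
  (A , B) ≤ (C , D) = (A ⊆ C) × (B ⊆ D)

  _∧_ : Pair U → Pair U → Pair U
  (A , B) ∧ (C , D) = (λ x → A x × C x) , (λ x → B x × D x)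

  _∨_ : Pair U → Pair U → Pair U
  (A , B) ∨ (C , D) = (λ x → A x ⊎ C x) , (λ x → B x ⊎ D x)

  ∼ : Pair U → Pair U
  ∼ (A , B) = (B ᶜ) , (A ᶜ)

  IsRPC : Pair U → Pair U → Pair U → Set (suc ℓ)
  IsRPC a b r = InRS r × ((a ∧ r) ≤ b)
              × (∀ c → InRS c → (a ∧ c) ≤ b → c ≤ r)

  module Arrows (_⇒*_ : Pair U → Pair U → Pair U) where
    _⟶_ : Pair U → Pair U → Pair U
    a ⟶ b = a ⇒* (∼ a ∨ b)

    _⇒_ : Pair U → Pair U → Pair U
    a ⇒ b = (a ⟶ b) ∧ (∼ b ⟶ ∼ a)

{-# OPTIONS --safe #-}
-- The second inequality holds because a ⇒ b is a meet with a → b as one side.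
-- For the first, a ⇒* b lies below a ⇒* (∼a ∨ b) = a → b since b ≤ ∼a ∨ b, and
-- below ∼b ⇒* (∼∼b ∨ ∼a) = ∼b → ∼a because ∼b ∧ (a ⇒* b) ≤ ∼∼b ∨ ∼a by
-- contraposition, using A ⊆ B for every (A , B) ∈ RS. Both steps need the
-- arguments of ⇒* to lie in RS, i.e. that RS is closed under ∼ (witnessed by
-- the complement Xᶜ) and under ∨ (witnessed by an explicit set Z).
module Submission where

open import Defs
open import Level using (Level)
open import Data.Product using (_×_; _,_; proj₁; proj₂; ∃)
open import Data.Sum using (_⊎_; inj₁; inj₂)
open import Data.Empty using (⊥-elim)
open import Relation.Nullary using (¬_; yes; no)
open import Relation.Unary using (_∪_; _∩_)
open import Relation.Binary using (Rel; IsPreorder)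
open import Relation.Binary.PropositionalEquality using (_≡_)
open import Axiom.ExcludedMiddle using (ExcludedMiddle)

module RoughSetProperties {ℓ : Level} {U : Set ℓ} {_≲_ : Rel U ℓ} where
  open RoughSets U _≲_

  private
    variable
      X Y X′ Y′ : Subset U
      a b c r : Pair U

  ≐-sym : X ≐ Y → Y ≐ X
  ≐-sym (X⊆Y , Y⊆X) = Y⊆X , X⊆Y

  ≐-trans : X ≐ Y → Y ≐ X′ → X ≐ X′
  ≐-trans (X⊆Y , Y⊆X) (Y⊆X′ , X′⊆Y) =
    (λ x Xx → Y⊆X′ x (X⊆Y x Xx)) , (λ x X′x → Y⊆X x (X′⊆Y x X′x))

  ᶜ-cong : X ≐ Y → (X ᶜ) ≐ (Y ᶜ)
  ᶜ-cong (X⊆Y , Y⊆X) = (λ x ¬Xx Yx → ¬Xx (Y⊆X x Yx)) , (λ x ¬Yx Xx → ¬Yx (X⊆Y x Xx))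

  ∪-cong : X ≐ X′ → Y ≐ Y′ → (X ∪ Y) ≐ (X′ ∪ Y′)
  ∪-cong (X⊆X′ , X′⊆X) (Y⊆Y′ , Y′⊆Y) =
    (λ { x (inj₁ Xx) → inj₁ (X⊆X′ x Xx) ; x (inj₂ Yx) → inj₂ (Y⊆Y′ x Yx) }) ,
    (λ { x (inj₁ X′x) → inj₁ (X′⊆X x X′x) ; x (inj₂ Y′x) → inj₂ (Y′⊆Y x Y′x) })

  ≤-trans : a ≤ b → b ≤ c → a ≤ c
  ≤-trans (A⊆B , A′⊆B′) (B⊆C , B′⊆C′) =
    (λ x Ax → B⊆C x (A⊆B x Ax)) , (λ x A′x → B′⊆C′ x (A′⊆B′ x A′x))

  x∧y≤x : (a ∧ b) ≤ a
  x∧y≤x = (λ _ → proj₁) , (λ _ → proj₁)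

  x≤y∨x : a ≤ (b ∨ a)
  x≤y∨x = (λ _ → inj₂) , (λ _ → inj₂)

  ∧-greatest : a ≤ b → a ≤ c → a ≤ (b ∧ c)
  ∧-greatest (A⊆B , A′⊆B′) (A⊆C , A′⊆C′) =
    (λ x Ax → A⊆B x Ax , A⊆C x Ax) , (λ x A′x → A′⊆B′ x A′x , A′⊆C′ x A′x)

  ▲-mono : X ⊆ Y → (X ▲) ⊆ (Y ▲)
  ▲-mono X⊆Y x (y , x≲y , Xy) = y , x≲y , X⊆Y y Xy

  ᶜ▼≐▲ᶜ : ((X ᶜ) ▼) ≐ ((X ▲) ᶜ)
  ᶜ▼≐▲ᶜ = (λ x ↑x⊆Xᶜ (y , x≲y , Xy) → ↑x⊆Xᶜ y x≲y Xy)
        , (λ x x∉X▲ y x≲y Xy → x∉X▲ (y , x≲y , Xy))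

  module Classical (em : ExcludedMiddle ℓ) where

    ¬▼⇒∃ᶜ : ∀ {x} → ¬ (X ▼) x → ∃ λ y → x ≲ y × ¬ X y
    ¬▼⇒∃ᶜ {X} {x} x∉X▼ with em {∃ λ y → x ≲ y × ¬ X y}
    ... | yes witness = witness
    ... | no none = ⊥-elim (x∉X▼ λ y x≲y → dec-stable y x≲y)
      where
      dec-stable : ∀ y → x ≲ y → X y
      dec-stable y x≲y with em {X y}
      ... | yes Xy = Xy
      ... | no y∉X = ⊥-elim (none (y , x≲y , y∉X))

    ᶜ▲≐▼ᶜ : ((X ᶜ) ▲) ≐ ((X ▼) ᶜ)
    ᶜ▲≐▼ᶜ = (λ x (y , x≲y , y∉X) ↑x⊆X → y∉X (↑x⊆X y x≲y))
          , (λ x x∉X▼ → ¬▼⇒∃ᶜ x∉X▼)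

    InRS-∼ : InRS a → InRS (∼ a)
    InRS-∼ (X , A≐X▼ , B≐X▲) =
      (X ᶜ) , ≐-trans (ᶜ-cong B≐X▲) (≐-sym ᶜ▼≐▲ᶜ) , ≐-trans (ᶜ-cong A≐X▼) (≐-sym ᶜ▲≐▼ᶜ)

    ∧-contrapose : proj₁ a ⊆ proj₂ a → proj₁ r ⊆ proj₂ r → (a ∧ r) ≤ b
                 → (∼ b ∧ r) ≤ (∼ (∼ b) ∨ ∼ a)
    ∧-contrapose {a = A , B} {r = R , R′} {b = _ , D} A⊆B R⊆R′ (_ , B∩R′⊆D) =
      (λ x (x∉D , Rx) → inj₂ λ Bx → x∉D (B∩R′⊆D x (Bx , R⊆R′ x Rx))) ,
      (λ x (_ , R′x) → case-A x R′x)
      where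
      case-A : ∀ x → R′ x → ((D ᶜ) ᶜ) x ⊎ (A ᶜ) x
      case-A x R′x with em {A x}
      ... | yes Ax = inj₁ λ x∉D → x∉D (B∩R′⊆D x (A⊆B x Ax , R′x))
      ... | no x∉A = inj₂ x∉A

  module _ (pre : IsPreorder _≡_ _≲_) where
    open IsPreorder pre using (refl; trans)

    ▼⊆▲ : (X ▼) ⊆ (X ▲)
    ▼⊆▲ x ↑x⊆X = x , refl , ↑x⊆X x refl

    InRS⇒proj₁⊆proj₂ : InRS a → proj₁ a ⊆ proj₂ a
    InRS⇒proj₁⊆proj₂ (X , (A⊆X▼ , _) , (_ , X▲⊆B)) x Ax = X▲⊆B x (▼⊆▲ x (A⊆X▼ x Ax))

    ▼-upward : ∀ {x y} → (X ▼) x → x ≲ y → (X ▼) y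
    ▼-upward ↑x⊆X x≲y z y≲z = ↑x⊆X z (trans x≲y y≲z)

    ▲ᶜ-upward : ∀ {x y} → ¬ (X ▲) x → x ≲ y → ¬ (X ▲) y
    ▲ᶜ-upward x∉X▲ x≲y (z , y≲z , Xz) = x∉X▲ (z , trans x≲y y≲z , Xz)

    module Join (em : ExcludedMiddle ℓ) (X Y : Subset U) where
      open Classical em

      Core : Subset U
      Core = (X ▼) ∪ (Y ▼)

      Far : Subset U
      Far = (Core ▲) ᶜ

      -- Points of Y are admitted only outside X▲: otherwise [x) ⊆ Z could
      -- hold with x ∉ Core, e.g. when X ∪ Y covers a single ≲-class.
      Z : Subset U
      Z = Core ∪ (Far ∩ (X ∪ (Y ∩ ((X ▲) ᶜ))))

      Z⊆X∪Y : Z ⊆ (X ∪ Y)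
      Z⊆X∪Y x (inj₁ (inj₁ ↑x⊆X)) = inj₁ (↑x⊆X x refl)
      Z⊆X∪Y x (inj₁ (inj₂ ↑x⊆Y)) = inj₂ (↑x⊆Y x refl)
      Z⊆X∪Y x (inj₂ (_ , inj₁ Xx)) = inj₁ Xx
      Z⊆X∪Y x (inj₂ (_ , inj₂ (Yx , _))) = inj₂ Yx

      Core⊆Z▼ : Core ⊆ (Z ▼)
      Core⊆Z▼ x (inj₁ x∈X▼) y x≲y = inj₁ (inj₁ (▼-upward x∈X▼ x≲y))
      Core⊆Z▼ x (inj₂ x∈Y▼) y x≲y = inj₁ (inj₂ (▼-upward x∈Y▼ x≲y))

      Z∖Core∖X⊆X▲ᶜ : ∀ {y} → Z y → ¬ Core y → ¬ X y → ¬ (X ▲) y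
      Z∖Core∖X⊆X▲ᶜ (inj₁ y∈Core) y∉Core _ = ⊥-elim (y∉Core y∈Core)
      Z∖Core∖X⊆X▲ᶜ (inj₂ (_ , inj₁ Xy)) _ y∉X = ⊥-elim (y∉X Xy)
      Z∖Core∖X⊆X▲ᶜ (inj₂ (_ , inj₂ (_ , y∉X▲))) _ _ = y∉X▲

      Far∩Z▼-Xᶜ⇒Y▼ : ∀ {x y} → Far x → (Z ▼) x → x ≲ y → ¬ X y → (Y ▼) y
      Far∩Z▼-Xᶜ⇒Y▼ {x} {y} x∈Far ↑x⊆Z x≲y y∉X z y≲z with ↑x⊆Z z (trans x≲y y≲z)
      ... | inj₁ z∈Core = ⊥-elim (x∈Far (z , trans x≲y y≲z , z∈Core))
      ... | inj₂ (_ , inj₁ Xz) = ⊥-elim (y∉X▲ (z , y≲z , Xz))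
        where
        y∉X▲ : ¬ (X ▲) y
        y∉X▲ = Z∖Core∖X⊆X▲ᶜ (↑x⊆Z y x≲y) (λ y∈Core → x∈Far (y , x≲y , y∈Core)) y∉X
      ... | inj₂ (_ , inj₂ (Yz , _)) = Yz

      Z▼⊆Core : (Z ▼) ⊆ Core
      Z▼⊆Core x ↑x⊆Z with ↑x⊆Z x refl
      ... | inj₁ x∈Core = x∈Core
      ... | inj₂ (x∈Far , _) with em {(X ▼) x}
      ...   | yes x∈X▼ = inj₁ x∈X▼
      ...   | no x∉X▼ with ¬▼⇒∃ᶜ x∉X▼
      ...     | y , x≲y , y∉X = ⊥-elim (x∈Far (y , x≲y , inj₂ (Far∩Z▼-Xᶜ⇒Y▼ x∈Far ↑x⊆Z x≲y y∉X)))

      Z▲⊆X▲∪Y▲ : (Z ▲) ⊆ ((X ▲) ∪ (Y ▲))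
      Z▲⊆X▲∪Y▲ x (y , x≲y , Zy) with Z⊆X∪Y y Zy
      ... | inj₁ Xy = inj₁ (y , x≲y , Xy)
      ... | inj₂ Yy = inj₂ (y , x≲y , Yy)

      X▲∪Y▲⊆Z▲ : ((X ▲) ∪ (Y ▲)) ⊆ (Z ▲)
      X▲∪Y▲⊆Z▲ x X▲∪Y▲x with em {(Core ▲) x}
      ... | yes x∈Core▲ = ▲-mono (λ _ → inj₁) x x∈Core▲
      X▲∪Y▲⊆Z▲ x (inj₁ (y , x≲y , Xy)) | no x∈Far =
        y , x≲y , inj₂ (▲ᶜ-upward x∈Far x≲y , inj₁ Xy)
      X▲∪Y▲⊆Z▲ x (inj₂ (y , x≲y , Yy)) | no x∈Far with em {(X ▲) x}
      ... | yes (z , x≲z , Xz) = z , x≲z , inj₂ (▲ᶜ-upward x∈Far x≲z , inj₁ Xz)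
      ... | no x∉X▲ = y , x≲y , inj₂ (▲ᶜ-upward x∈Far x≲y , inj₂ (Yy , ▲ᶜ-upward x∉X▲ x≲y))

      Z▼≐Core : (Z ▼) ≐ Core
      Z▼≐Core = Z▼⊆Core , Core⊆Z▼

      Z▲≐X▲∪Y▲ : (Z ▲) ≐ ((X ▲) ∪ (Y ▲))
      Z▲≐X▲∪Y▲ = Z▲⊆X▲∪Y▲ , X▲∪Y▲⊆Z▲

    InRS-∨ : ExcludedMiddle ℓ → InRS a → InRS b → InRS (a ∨ b)
    InRS-∨ em (X , A≐X▼ , B≐X▲) (Y , C≐Y▼ , D≐Y▲) =
      Z , ≐-trans (∪-cong A≐X▼ C≐Y▼) (≐-sym Z▼≐Core)
        , ≐-trans (∪-cong B≐X▲ D≐Y▲) (≐-sym Z▲≐X▲∪Y▲)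
      where open Join em X Y

  module Arrows-≤ (pre : IsPreorder _≡_ _≲_) (em : ExcludedMiddle ℓ)
    (_⇒*_ : Pair U → Pair U → Pair U)
    (isRPC : ∀ a b → InRS a → InRS b → IsRPC a b (a ⇒* b)) where
    open Classical em
    open Arrows _⇒*_

    ⇒*-greatest : InRS a → InRS b → InRS c → (a ∧ c) ≤ b → c ≤ (a ⇒* b)
    ⇒*-greatest {a} {b} {c} a∈RS b∈RS = proj₂ (proj₂ (isRPC a b a∈RS b∈RS)) c

    InRS-⇒* : InRS a → InRS b → InRS (a ⇒* b)
    InRS-⇒* {a} {b} a∈RS b∈RS = proj₁ (isRPC a b a∈RS b∈RS)

    x∧x⇒*y≤y : InRS a → InRS b → (a ∧ (a ⇒* b)) ≤ b
    x∧x⇒*y≤y {a} {b} a∈RS b∈RS = proj₁ (proj₂ (isRPC a b a∈RS b∈RS))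

    ⇒*≤⟶ : InRS a → InRS b → (a ⇒* b) ≤ (a ⟶ b)
    ⇒*≤⟶ a∈RS b∈RS =
      ⇒*-greatest a∈RS (InRS-∨ pre em (InRS-∼ a∈RS) b∈RS) (InRS-⇒* a∈RS b∈RS)
        (≤-trans (x∧x⇒*y≤y a∈RS b∈RS) x≤y∨x)

    ⇒*≤∼⟶∼ : InRS a → InRS b → (a ⇒* b) ≤ (∼ b ⟶ ∼ a)
    ⇒*≤∼⟶∼ a∈RS b∈RS =
      ⇒*-greatest ∼b∈RS (InRS-∨ pre em (InRS-∼ ∼b∈RS) (InRS-∼ a∈RS)) (InRS-⇒* a∈RS b∈RS)
        (∧-contrapose (InRS⇒proj₁⊆proj₂ pre a∈RS)
                      (InRS⇒proj₁⊆proj₂ pre (InRS-⇒* a∈RS b∈RS))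
                      (x∧x⇒*y≤y a∈RS b∈RS))
      where ∼b∈RS = InRS-∼ b∈RS

proposition4p27 : ∀ {ℓ : Level} (U : Set ℓ) (_≲_ : Rel U ℓ)
    → IsPreorder _≡_ _≲_
    → ExcludedMiddle ℓ
    → (_⇒*_ : Pair U → Pair U → Pair U)
    → (∀ a b → RoughSets.InRS U _≲_ a → RoughSets.InRS U _≲_ b → RoughSets.IsRPC U _≲_ a b (a ⇒* b))
    → ∀ a b → RoughSets.InRS U _≲_ a → RoughSets.InRS U _≲_ b
    → RoughSets._≤_ U _≲_ (a ⇒* b) (RoughSets.Arrows._⇒_ U _≲_ _⇒*_ a b)
    × RoughSets._≤_ U _≲_ (RoughSets.Arrows._⇒_ U _≲_ _⇒*_ a b) (RoughSets.Arrows._⟶_ U _≲_ _⇒*_ a b)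
proposition4p27 U _≲_ pre em _⇒*_ isRPC a b a∈RS b∈RS =
  ∧-greatest (⇒*≤⟶ a∈RS b∈RS) (⇒*≤∼⟶∼ a∈RS b∈RS) , x∧y≤x
  where
  open RoughSetProperties {U = U} {_≲_ = _≲_}
  open Arrows-≤ pre em _⇒*_ isRPC
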